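{- Let $G$ be a strongly connected compressed directed graph that is not a closed path. Every maximal omnitig of $G$ contains both a join arc and a split arc. Moreover, every maximal omnitig of $G$ contains a bivalent arc or has a bivalent node as an internal node.
   Context: Graphs are finite directed multigraphs (parallel arcs and self-loops allowed); $t(e)$, $h(e)$ are tail and head of arc $e$. A walk $W=(v_0,e_1,v_1,\dots,e_\ell,v_\ell)$ has internal nodes $v_1,\dots,v_{\ell-1}$; a path is a walk with distinct nodes except $v_\ell=v_0$ allowed. A closed path is a graph consisting of a single cycle. A node is a join node if its in-degree exceeds 1, a split node if its out-degree exceeds 1, bivalent if both, biunivocal if neither. An arc $e$ is a join arc if $h(e)$ is a join node, a split arc if $t(e)$ is a split node, bivalent if both, biunivocal if neither. A graph is compressed if it has no biunivocal nodes and no biunivocal arcs. A walk $W=e_0\dots e_\ell$ is an omnitig if for all $1\le i\le j\le \ell$ there is no non-empty path from $t(e_j)$ to $h(e_{i-1})$ whose first arc differs from $e_j$ and whose last arc differs from $e_{i-1}$; it is maximal if there is no arc $e$ with $eW$ or $We$ an omnitig. -}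

module Defs where

open import Data.Nat using (ℕ; _<_; _≤_)
open import Data.Fin using (Fin; toℕ; _≟_)
open import Data.List using (List; []; _∷_; map; filter; length; allFin)
open import Data.List.NonEmpty using (List⁺; _∷_; toList; head; last; tail; _∷⁺_; _⁺∷ʳ_)
open import Data.List.Relation.Unary.Unique.Propositional using (Unique)
open import Data.List.Relation.Unary.Any using (Any)
open import Data.List.Membership.Propositional using (_∈_)
open import Data.Product using (Σ; _×_; ∃)
open import Relation.Binary.PropositionalEquality using (_≡_; _≢_)
open import Relation.Nullary using (¬_)

-- A finite directed multigraph: nodes Fin nV, arcs Fin nA, tail/head maps
-- (parallel arcs and self-loops allowed).
record Graph : Set where
  field
    nV : ℕ
    nA : ℕ
    tl : Fin nA → Fin nV
    hd : Fin nA → Fin nV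

module _ (G : Graph) where
  open Graph G

  Node : Set
  Node = Fin nV

  Arc : Set
  Arc = Fin nA

  WalkFrom : Node → Node → List Arc → Set
  WalkFrom u v []       = u ≡ v
  WalkFrom u v (e ∷ es) = (tl e ≡ u) × WalkFrom (hd e) v es

  IsWalk : List⁺ Arc → Set
  IsWalk W = WalkFrom (tl (head W)) (hd (last W)) (toList W)

  -- Non-empty path from u to v: a walk v_0 e_1 v_1 … e_ℓ v_ℓ with v_0 = u, v_ℓ = v,
  -- whose nodes are distinct except that v_ℓ = v_0 is allowed; written out as:
  -- v_0,…,v_{ℓ-1} (the tails) are distinct and v_1,…,v_ℓ (the heads) are distinct.
  IsPath : Node → Node → List⁺ Arc → Set
  IsPath u v P = WalkFrom u v (toList P)
               × Unique (map tl (toList P))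
               × Unique (map hd (toList P))

  -- internal nodes v_1 … v_{ℓ-1} of a walk (= tails of all arcs but the first)
  internalNodes : List⁺ Arc → List Node
  internalNodes W = map tl (tail W)

  indeg : Node → ℕ
  indeg v = length (filter (λ e → hd e ≟ v) (allFin nA))

  outdeg : Node → ℕ
  outdeg v = length (filter (λ e → tl e ≟ v) (allFin nA))

  JoinNode SplitNode BivalentNode BiunivocalNode : Node → Set
  JoinNode v = 1 < indeg v
  SplitNode v = 1 < outdeg v
  BivalentNode v = JoinNode v × SplitNode v
  BiunivocalNode v = ¬ JoinNode v × ¬ SplitNode v

  JoinArc SplitArc BivalentArc BiunivocalArc : Arc → Set
  JoinArc e = JoinNode (hd e)
  SplitArc e = SplitNode (tl e)
  BivalentArc e = JoinArc e × SplitArc e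
  BiunivocalArc e = ¬ JoinArc e × ¬ SplitArc e

  Compressed : Set
  Compressed = ((v : Node) → ¬ BiunivocalNode v) × ((e : Arc) → ¬ BiunivocalArc e)

  StronglyConnected : Set
  StronglyConnected = (u v : Node) → Σ (List Arc) (WalkFrom u v)

  -- G is a closed path: G consists of a single cycle, i.e. there is a closed
  -- (non-empty) path through which every arc and every node of G appear.
  IsClosedPath : Set
  IsClosedPath = Σ (List⁺ Arc) λ C →
      IsPath (tl (head C)) (tl (head C)) C
    × ((e : Arc) → e ∈ toList C)
    × ((v : Node) → v ∈ map tl (toList C))

  -- W = e_0 … e_ℓ is an omnitig: it is a walk and for all 1 ≤ i ≤ j ≤ ℓ there is no
  -- non-empty path from t(e_j) to h(e_{i-1}) with first arc ≠ e_j and last arc ≠ e_{i-1}.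
  -- (indices below: a = i-1, b = j, so a < b.)
  IsOmnitig : List⁺ Arc → Set
  IsOmnitig W = IsWalk W ×
    ((a b : Fin (length (toList W))) → toℕ a < toℕ b →
      let ea = Data.List.lookup (toList W) a
          eb = Data.List.lookup (toList W) b
      in ¬ (Σ (List⁺ Arc) λ P → IsPath (tl eb) (hd ea) P
                               × head P ≢ eb × last P ≢ ea))

  MaximalOmnitig : List⁺ Arc → Set
  MaximalOmnitig W = IsOmnitig W
    × ((e : Arc) → ¬ IsOmnitig (e ∷⁺ W))
    × ((e : Arc) → ¬ IsOmnitig (W ⁺∷ʳ e))

-- Maximality forces a join arc: if no arc of W were a join arc, then W extended by any arc
-- leaving its last node (one exists by strong connectivity) would still be an omnitig,
-- because a forbidden path ending in h(e_{i-1}) with a last arc different from e_{i-1}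
-- makes e_{i-1} a join arc. Symmetrically W contains a split arc. In a compressed graph,
-- walking along W without meeting a bivalent arc or internal node, a join arc is always
-- followed by a join arc and a split arc by a split arc, so the last arc would be bivalent.
module Submission where

open import Defs
open import Data.List.NonEmpty using (List⁺; toList)
open import Data.List.Relation.Unary.Any using (Any)
open import Data.Product using (_×_)
open import Data.Sum using (_⊎_)
open import Relation.Nullary using (¬_)

open import Data.Nat using (_<_; _≤_; s≤s; z≤n; _<?_)
open import Data.Nat.Properties using (m≤n⇒m≤1+n)
open import Data.Fin using (Fin; toℕ; _≟_) renaming (zero to fzero; suc to fsuc)
open import Data.List using (List; []; _∷_; _++_; _∷ʳ_; length; lookup; map)
open import Data.List.NonEmpty using (_∷_; head; last; snocView; _∷⁺_; _⁺∷ʳ_)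
  renaming (_∷ʳ_ to _∷ʳ⁺_; _∷ʳ′_ to _∷ʳ⁺′_)
open import Data.List.Relation.Unary.Any using (here; there; any?)
open import Data.List.Membership.Propositional using (_∈_; lose)
open import Data.List.Membership.Propositional.Properties using (∈-filter⁺; ∈-allFin; ∈-lookup)
open import Data.Product using (∃; _,_)
import Data.Sum as Sum
open import Data.Empty using (⊥-elim)
open import Relation.Nullary using (yes; no; Dec; _×-dec_)
open import Relation.Nullary.Decidable using (decidable-stable)
open import Relation.Binary.PropositionalEquality using (_≡_; _≢_; refl; sym; subst)

private
  variable
    A : Set

toList-∷ʳ : (xs : List A) (y : A) → toList (xs ∷ʳ⁺ y) ≡ xs ∷ʳ y
toList-∷ʳ []       y = refl
toList-∷ʳ (x ∷ xs) y = refl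

≢-∈-∈⇒2≤length : ∀ {x y : A} (xs : List A) → x ≢ y → x ∈ xs → y ∈ xs → 2 ≤ length xs
≢-∈-∈⇒2≤length (_ ∷ _)     x≢y (here refl) (here refl) = ⊥-elim (x≢y refl)
≢-∈-∈⇒2≤length (_ ∷ _ ∷ _) x≢y (here _)    (there _)   = s≤s (s≤s z≤n)
≢-∈-∈⇒2≤length (_ ∷ _ ∷ _) x≢y (there _)   (here _)    = s≤s (s≤s z≤n)
≢-∈-∈⇒2≤length (_ ∷ xs)    x≢y (there x∈)  (there y∈)  = m≤n⇒m≤1+n (≢-∈-∈⇒2≤length xs x≢y x∈ y∈)

lookup-∈-init : (xs : List A) (y : A) (a b : Fin (length (xs ∷ʳ y))) →
  toℕ a < toℕ b → lookup (xs ∷ʳ y) a ∈ xs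
lookup-∈-init []       y fzero    fzero    ()
lookup-∈-init (x ∷ xs) y fzero    b        _         = here refl
lookup-∈-init (x ∷ xs) y (fsuc a) (fsuc b) (s≤s a<b) = there (lookup-∈-init xs y a b a<b)

lookup-∈-tail : (x : A) (xs : List A) (a b : Fin (length (x ∷ xs))) →
  toℕ a < toℕ b → lookup (x ∷ xs) b ∈ xs
lookup-∈-tail x xs a (fsuc b) _ = ∈-lookup b

Any-tail : ∀ {P : A → Set} {x xs} → (P x → Any P xs) → Any P (x ∷ xs) → Any P xs
Any-tail shift (here px)  = shift px
Any-tail shift (there p) = p

module _ (G : Graph) where
  open Graph G

  WalkFrom-++ : ∀ {u v w} (xs : List (Arc G)) {ys} →
    WalkFrom G u v xs → WalkFrom G v w ys → WalkFrom G u w (xs ++ ys)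
  WalkFrom-++ []       refl        q = q
  WalkFrom-++ (x ∷ xs) (tl≡ , p) q = tl≡ , WalkFrom-++ xs p q

  WalkFrom-∷ʳ⁻ : ∀ {u w} (xs : List (Arc G)) (y : Arc G) → WalkFrom G u w (xs ∷ʳ y) → hd y ≡ w
  WalkFrom-∷ʳ⁻ []       y (_ , hd≡) = hd≡
  WalkFrom-∷ʳ⁻ (x ∷ xs) y (_ , p)   = WalkFrom-∷ʳ⁻ xs y p

  hd-last : ∀ {u v} (P : List⁺ (Arc G)) → WalkFrom G u v (toList P) → hd (last P) ≡ v
  hd-last {u} {v} P p with snocView P
  ... | xs ∷ʳ⁺′ y = WalkFrom-∷ʳ⁻ xs y (subst (WalkFrom G u v) (toList-∷ʳ xs y) p)

  WalkFrom⇒IsWalk : ∀ {v} (P : List⁺ (Arc G)) → WalkFrom G (tl (head P)) v (toList P) → IsWalk G P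
  WalkFrom⇒IsWalk P p = subst (λ v → WalkFrom G _ v (toList P)) (sym (hd-last P p)) p

  IsWalk-⁺∷ʳ : (W : List⁺ (Arc G)) (f : Arc G) → IsWalk G W → tl f ≡ hd (last W) → IsWalk G (W ⁺∷ʳ f)
  IsWalk-⁺∷ʳ (w ∷ ws) f walk f-from =
    WalkFrom⇒IsWalk ((w ∷ ws) ⁺∷ʳ f) (WalkFrom-++ (w ∷ ws) walk (f-from , refl))

  IsWalk-∷⁺ : (W : List⁺ (Arc G)) (f : Arc G) → IsWalk G W → hd f ≡ tl (head W) → IsWalk G (f ∷⁺ W)
  IsWalk-∷⁺ (w ∷ ws) f walk f-into =
    WalkFrom⇒IsWalk (f ∷⁺ (w ∷ ws))
      (refl , subst (λ u → WalkFrom G u (hd (last (w ∷ ws))) (w ∷ ws)) (sym f-into) walk)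

  ∃-arc-from : StronglyConnected G → Arc G → (v : Node G) → ∃ λ f → tl f ≡ v
  ∃-arc-from sc e v with sc v (tl e)
  ... | []    , refl     = e , refl
  ... | f ∷ _ , (tl≡ , _) = f , tl≡

  ∃-arc-into : StronglyConnected G → Arc G → (v : Node G) → ∃ λ f → hd f ≡ v
  ∃-arc-into sc e v with sc (hd e) v
  ... | []     , refl = e , refl
  ... | f ∷ fs , p    = last (f ∷ fs) , hd-last (f ∷ fs) p

  join? : (v : Node G) → Dec (JoinNode G v)
  join? v = 1 <? indeg G v

  split? : (v : Node G) → Dec (SplitNode G v)
  split? v = 1 <? outdeg G v

  ≢-hd≡-hd≡⇒JoinNode : ∀ {v} {e f : Arc G} → e ≢ f → hd e ≡ v → hd f ≡ v → JoinNode G v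
  ≢-hd≡-hd≡⇒JoinNode {v} {e} {f} e≢f e-into f-into = ≢-∈-∈⇒2≤length _ e≢f
    (∈-filter⁺ (λ e → hd e ≟ v) (∈-allFin e) e-into) (∈-filter⁺ (λ e → hd e ≟ v) (∈-allFin f) f-into)

  ≢-tl≡-tl≡⇒SplitNode : ∀ {v} {e f : Arc G} → e ≢ f → tl e ≡ v → tl f ≡ v → SplitNode G v
  ≢-tl≡-tl≡⇒SplitNode {v} {e} {f} e≢f e-from f-from = ≢-∈-∈⇒2≤length _ e≢f
    (∈-filter⁺ (λ e → tl e ≟ v) (∈-allFin e) e-from) (∈-filter⁺ (λ e → tl e ≟ v) (∈-allFin f) f-from)

  ⁺∷ʳ-isOmnitig : (W : List⁺ (Arc G)) (f : Arc G) → IsWalk G (W ⁺∷ʳ f) →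
    ¬ Any (JoinArc G) (toList W) → IsOmnitig G (W ⁺∷ʳ f)
  ⁺∷ʳ-isOmnitig (w ∷ ws) f walk no-join = walk , λ where
    a b a<b (P , (P-walk , _) , _ , last≢ea) → no-join (lose (lookup-∈-init (w ∷ ws) f a b a<b)
      (≢-hd≡-hd≡⇒JoinNode last≢ea (hd-last P P-walk) refl))

  ∷⁺-isOmnitig : (W : List⁺ (Arc G)) (f : Arc G) → IsWalk G (f ∷⁺ W) →
    ¬ Any (SplitArc G) (toList W) → IsOmnitig G (f ∷⁺ W)
  ∷⁺-isOmnitig (w ∷ ws) f walk no-split = walk , λ where
    a b a<b (p ∷ ps , ((tl≡ , _) , _) , head≢eb , _) → no-split (lose (lookup-∈-tail f (w ∷ ws) a b a<b)
      (≢-tl≡-tl≡⇒SplitNode head≢eb tl≡ refl))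

  maximalOmnitig⇒joinArc : StronglyConnected G → (W : List⁺ (Arc G)) → MaximalOmnitig G W →
    Any (JoinArc G) (toList W)
  maximalOmnitig⇒joinArc sc W ((walk , _) , _ , not-right-extensible)
    with any? (λ e → join? (hd e)) (toList W)
  ... | yes join = join
  ... | no no-join with ∃-arc-from sc (head W) (hd (last W))
  ...   | f , f-from = ⊥-elim (not-right-extensible f
            (⁺∷ʳ-isOmnitig W f (IsWalk-⁺∷ʳ W f walk f-from) no-join))

  maximalOmnitig⇒splitArc : StronglyConnected G → (W : List⁺ (Arc G)) → MaximalOmnitig G W →
    Any (SplitArc G) (toList W)
  maximalOmnitig⇒splitArc sc W ((walk , _) , not-left-extensible , _)
    with any? (λ e → split? (tl e)) (toList W)
  ... | yes split = split
  ... | no no-split with ∃-arc-into sc (head W) (tl (head W))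
  ...   | f , f-into = ⊥-elim (not-left-extensible f
            (∷⁺-isOmnitig W f (IsWalk-∷⁺ W f walk f-into) no-split))

  bivalentArc? : (e : Arc G) → Dec (BivalentArc G e)
  bivalentArc? e = join? (hd e) ×-dec split? (tl e)

  bivalentNode? : (v : Node G) → Dec (BivalentNode G v)
  bivalentNode? v = join? v ×-dec split? v

  joinArc-next : Compressed G → ∀ {e f} → tl f ≡ hd e →
    JoinArc G e → ¬ BivalentNode G (hd e) → JoinArc G f
  joinArc-next (_ , no-biunivocal-arc) {e} {f} tl≡ join-e ¬biv =
    decidable-stable (join? (hd f)) λ ¬join-f →
      no-biunivocal-arc f (¬join-f , λ split-f → ¬biv (join-e , subst (SplitNode G) tl≡ split-f))

  splitArc-next : Compressed G → ∀ {e f} → tl f ≡ hd e →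
    SplitArc G e → ¬ BivalentArc G e → SplitArc G f
  splitArc-next (no-biunivocal-node , _) {e} tl≡ split-e ¬biv =
    subst (SplitNode G) (sym tl≡) (decidable-stable (split? (hd e)) λ ¬split-v →
      no-biunivocal-node (hd e) ((λ join-v → ¬biv (join-v , split-e)) , ¬split-v))

  join-split-walk⇒bivalent : Compressed G → ∀ {u v} (e : Arc G) (es : List (Arc G)) →
    WalkFrom G u v (e ∷ es) → Any (JoinArc G) (e ∷ es) → Any (SplitArc G) (e ∷ es) →
    Any (BivalentArc G) (e ∷ es) ⊎ Any (BivalentNode G) (map tl es)
  join-split-walk⇒bivalent cp e [] _ (here join) (here split) = Sum.inj₁ (here (join , split))
  join-split-walk⇒bivalent cp e (f ∷ es) (_ , tl≡ , walk) joins splits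
    with bivalentArc? e | bivalentNode? (hd e)
  ... | yes biv-e | _         = Sum.inj₁ (here biv-e)
  ... | no _      | yes biv-v = Sum.inj₂ (here (subst (BivalentNode G) (sym tl≡) biv-v))
  ... | no ¬biv-e | no ¬biv-v = Sum.map there there (join-split-walk⇒bivalent cp f es (tl≡ , walk)
        (Any-tail (λ join-e → here (joinArc-next cp tl≡ join-e ¬biv-v)) joins)
        (Any-tail (λ split-e → here (splitArc-next cp tl≡ split-e ¬biv-e)) splits))

lemma10 : (G : Graph) → StronglyConnected G → Compressed G → ¬ IsClosedPath G →
    (W : List⁺ (Arc G)) → MaximalOmnitig G W →
    (Any (JoinArc G) (toList W) × Any (SplitArc G) (toList W))
    × (Any (BivalentArc G) (toList W) ⊎ Any (BivalentNode G) (internalNodes G W))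
lemma10 G sc cp _ (w ∷ ws) maximal@((walk , _) , _) =
  (joins , splits) , join-split-walk⇒bivalent G cp w ws walk joins splits
  where
  joins : Any (JoinArc G) (w ∷ ws)
  joins = maximalOmnitig⇒joinArc G sc (w ∷ ws) maximal
  splits : Any (SplitArc G) (w ∷ ws)
  splits = maximalOmnitig⇒splitArc G sc (w ∷ ws) maximal
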